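{- Let $n=n_1n_2\cdots n_r$ be a good factorization of a positive integer $n$, let $I$ be a nonempty subset of $\{1,\dots,r\}$, and let $m=\prod_{i\in I}n_i$. If $n$ is a leader, then so is $m$. If $n$ is stable, then so is $m$.
   Context: For a positive integer $n$, its complexity $\|n\|$ is the least number of $1$'s needed to write $n$ using only the constant $1$, addition, multiplication, and parentheses (so $\|1\|=1$ and for $n>1$, $\|n\|=\min\{\|a\|+\|b\|: a,b<n,\ a+b=n \text{ or } ab=n\}$). A factorization $n=u_1\cdots u_k$ into positive integers is a good factorization if $\|n\|=\|u_1\|+\cdots+\|u_k\|$. A positive integer $n$ is a leader if it is not the case that $3\mid n$ and $\|n\|=3+\|n/3\|$. A positive integer $m$ is stable if $\|3^km\|=3k+\|m\|$ for every integer $k\ge1$. -}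

module Defs where

open import Data.Nat using (ℕ; zero; suc; _+_; _*_; _∸_; _^_; _≤_; _<_; _⊓_)
open import Data.Nat.DivMod using (_/_; _%_)
open import Data.Nat.Divisibility using (_∣_)
open import Data.Bool using (if_then_else_)
open import Data.List using (List; []; _∷_; map; foldr; upTo; _++_; concatMap)
open import Data.Fin using (Fin; zero; suc)
open import Data.Fin.Subset using (Subset; inside; outside)
open import Data.Vec using ([]; _∷_)
open import Data.Product using (_×_)
open import Relation.Nullary using (¬_)
open import Relation.Nullary.Decidable using (⌊_⌋)
import Data.Nat as N
open import Relation.Binary.PropositionalEquality using (_≡_; refl)

-- For n ≥ 2: additive splits a + (n - a) with 1 ≤ a ≤ n-1, and
-- multiplicative splits a * (n / a) with 2 ≤ a ≤ n-1 and a ∣ n.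
cpxF : ℕ → ℕ → ℕ
cpxF zero    n = n  -- unreachable when fuel ≥ n (see ‖_‖)
cpxF (suc f) zero = 0          -- junk value: ‖0‖ is never used
cpxF (suc f) (suc zero) = 1
cpxF (suc f) n@(suc (suc _)) =
  foldr _⊓_ n (adds ++ muls)
  where
  adds : List ℕ
  adds = map (λ k → cpxF f (suc k) + cpxF f (n ∸ suc k)) (upTo (n ∸ 1))
  muls : List ℕ
  muls = concatMap
    (λ k → if ⌊ (n % (2 + k)) N.≟ 0 ⌋
             then (cpxF f (2 + k) + cpxF f (n / (2 + k))) ∷ []
             else [])
    (upTo (n ∸ 2))

-- Integer complexity ‖n‖ (fuel n suffices since all recursive arguments are
-- positive and strictly smaller; the initial value n of the minimum is an
-- upper bound already attained by the split 1 + (n-1)).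
‖_‖ : ℕ → ℕ
‖ n ‖ = cpxF n n

prodAll : ∀ {r} → (Fin r → ℕ) → ℕ
prodAll {zero}  u = 1
prodAll {suc r} u = u zero * prodAll (λ i → u (suc i))

sumCpx : ∀ {r} → (Fin r → ℕ) → ℕ
sumCpx {zero}  u = 0
sumCpx {suc r} u = ‖ u zero ‖ + sumCpx (λ i → u (suc i))

prodOver : ∀ {r} → (Fin r → ℕ) → Subset r → ℕ
prodOver {zero}  u []             = 1
prodOver {suc r} u (inside  ∷ I) = u zero * prodOver (λ i → u (suc i)) I
prodOver {suc r} u (outside ∷ I) = prodOver (λ i → u (suc i)) I

GoodFactorization : ℕ → ∀ {r} → (Fin r → ℕ) → Set
GoodFactorization n u = (∀ i → 0 < u i) × (prodAll u ≡ n) × (‖ n ‖ ≡ sumCpx u)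

Leader : ℕ → Set
Leader n = ¬ ((3 ∣ n) × (‖ n ‖ ≡ 3 + ‖ n / 3 ‖))

Stable : ℕ → Set
Stable m = ∀ k → 1 ≤ k → ‖ 3 ^ k * m ‖ ≡ 3 * k + ‖ m ‖

{-# OPTIONS --safe #-}
module Submission where

-- Let m′ be the product of the factors outside I and c the sum of their complexities.
-- Goodness forces ‖ n ‖ = ‖ m ‖ + c, while submultiplicativity gives ‖ x m′ ‖ ≤ ‖ x ‖ + c
-- for every x. Hence a saving in ‖ 3 ^ k m ‖, or in splitting a factor 3 off m, would
-- carry over to n = m m′.

open import Defs
open import Algebra.Properties.CommutativeSemigroup using (x∙yz≈y∙xz)
open import Data.Bool using (if_then_else_)
open import Data.Fin using (Fin; zero; suc)
open import Data.Fin.Subset using (Subset; inside; outside; Nonempty; ∁)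
open import Data.List using (List; []; _∷_; map; foldr; upTo; _++_; concat)
open import Data.List.Membership.Propositional using (_∈_)
open import Data.List.Membership.Propositional.Properties
  using (∈-upTo⁺; ∈-upTo⁻; ∈-++⁺ʳ; ∈-concatMap⁺)
open import Data.List.Properties using (map-cong-local)
import Data.List.Relation.Unary.All as All
import Data.List.Relation.Unary.Any as Any
open import Data.Nat
open import Data.Nat.DivMod using (_/_; _%_; m*n%n≡0; m*n/n≡m; m/n<m)
open import Data.Nat.Divisibility using (_∣_; divides)
open import Data.Nat.Properties
open import Data.Product using (_×_; _,_)
open import Data.Vec using ([]; _∷_; there)
open import Relation.Nullary.Decidable using (⌊_⌋)
open import Relation.Binary.PropositionalEquality

foldr-⊓-≤ : ∀ z {x} {xs : List ℕ} → x ∈ xs → foldr _⊓_ z xs ≤ x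
foldr-⊓-≤ z {xs = y ∷ _} (Any.here refl) = m⊓n≤m y _
foldr-⊓-≤ z {xs = y ∷ _} (Any.there x∈) = ≤-trans (m⊓n≤n y _) (foldr-⊓-≤ z x∈)

map-upTo-cong : ∀ {B : Set} l {f g : ℕ → B} → (∀ k → k < l → f k ≡ g k) →
                map f (upTo l) ≡ map g (upTo l)
map-upTo-cong l f≗g = map-cong-local (All.tabulate (λ {k} k∈ → f≗g k (∈-upTo⁻ k∈)))

cpxF-fuel : ∀ f g n → n ≤ f → n ≤ g → cpxF f n ≡ cpxF g n
cpxF-fuel zero    zero    n             _       _       = refl
cpxF-fuel zero    (suc g) zero          _       _       = refl
cpxF-fuel (suc f) zero    zero          _       _       = refl
cpxF-fuel (suc f) (suc g) zero          _       _       = refl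
cpxF-fuel (suc f) (suc g) (suc zero)    _       _       = refl
cpxF-fuel (suc f) (suc g) (suc (suc x)) (s≤s p) (s≤s q) =
  cong₂ (λ as ms → foldr _⊓_ (2 + x) (as ++ ms)) adds (cong concat muls)
  where
  same : ∀ {n} → n ≤ suc x → cpxF f n ≡ cpxF g n
  same n≤ = cpxF-fuel f g _ (≤-trans n≤ p) (≤-trans n≤ q)
  adds = map-upTo-cong (suc x) λ k k< → cong₂ _+_ (same k<) (same (m∸n≤m (suc x) k))
  muls = map-upTo-cong x λ k k< →
    cong (λ v → if ⌊ (2 + x) % (2 + k) ≟ 0 ⌋ then v ∷ [] else [])
         (cong₂ _+_ (same (s≤s k<)) (same (s≤s⁻¹ (m/n<m (2 + x) (2 + k) (s≤s (s≤s z≤n))))))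

‖‖≤-divisor-split : ∀ x k → k < x → (2 + x) % (2 + k) ≡ 0 →
                    ‖ 2 + x ‖ ≤ cpxF (suc x) (2 + k) + cpxF (suc x) ((2 + x) / (2 + k))
‖‖≤-divisor-split x k k<x k+2∣ =
  foldr-⊓-≤ (2 + x)
    (∈-++⁺ʳ additive (∈-concatMap⁺ multiplicative (Any.map (λ { refl → chosen k+2∣ }) (∈-upTo⁺ k<x))))
  where
  additive : List ℕ
  additive = map (λ j → cpxF (suc x) (suc j) + cpxF (suc x) (2 + x ∸ suc j)) (upTo (suc x))
  multiplicative : ℕ → List ℕ
  multiplicative j = if ⌊ (2 + x) % (2 + j) ≟ 0 ⌋
                     then (cpxF (suc x) (2 + j) + cpxF (suc x) ((2 + x) / (2 + j))) ∷ [] else []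
  chosen : ∀ {v : ℕ} {r} → r ≡ 0 → v ∈ (if ⌊ r ≟ 0 ⌋ then v ∷ [] else [])
  chosen refl = Any.here refl

‖*‖≤-≥2 : ∀ k j {x} → (2 + k) * (2 + j) ≡ 2 + x → ‖ 2 + x ‖ ≤ ‖ 2 + k ‖ + ‖ 2 + j ‖
‖*‖≤-≥2 k j {x} ab≡ = begin
  ‖ 2 + x ‖                                   ≤⟨ ‖‖≤-divisor-split x k (s≤s⁻¹ a≤) a∣ ⟩
  cpxF (suc x) a + cpxF (suc x) ((2 + x) / a) ≡⟨ cong (λ d → cpxF (suc x) a + cpxF (suc x) d) n/a≡b ⟩
  cpxF (suc x) a + cpxF (suc x) b             ≡⟨ cong₂ _+_ (cpxF-fuel _ _ a a≤ ≤-refl)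
                                                           (cpxF-fuel _ _ b b≤ ≤-refl) ⟩
  ‖ a ‖ + ‖ b ‖                               ∎
  where
  open ≤-Reasoning
  a = 2 + k
  b = 2 + j
  n≡ba : 2 + x ≡ b * a
  n≡ba = trans (sym ab≡) (*-comm a b)
  a≤ : a ≤ suc x
  a≤ = s≤s⁻¹ (subst (a <_) ab≡ (m<m*n a b (s≤s (s≤s z≤n))))
  b≤ : b ≤ suc x
  b≤ = s≤s⁻¹ (subst (b <_) (sym n≡ba) (m<m*n b a (s≤s (s≤s z≤n))))
  a∣ : (2 + x) % a ≡ 0
  a∣ = trans (cong (_% a) n≡ba) (m*n%n≡0 b a)
  n/a≡b : (2 + x) / a ≡ b
  n/a≡b = trans (cong (_/ a) n≡ba) (m*n/n≡m b a)

-- No positivity hypothesis: the junk value ‖ 0 ‖ = 0 makes the bound hold for a factor 0,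
-- which is why positivity of n and of the factors is never used below.
‖*‖≤ : ∀ a b → ‖ a * b ‖ ≤ ‖ a ‖ + ‖ b ‖
‖*‖≤ zero          b             = z≤n
‖*‖≤ (suc zero)    b             = ≤-trans (≤-reflexive (cong ‖_‖ (*-identityˡ b))) (n≤1+n _)
‖*‖≤ (suc (suc k)) zero          = ≤-trans (≤-reflexive (cong ‖_‖ (*-zeroʳ k))) z≤n
‖*‖≤ (suc (suc k)) (suc zero)    = ≤-trans (≤-reflexive (cong ‖_‖ (*-identityʳ (2 + k)))) (m≤m+n _ _)
‖*‖≤ (suc (suc k)) (suc (suc j)) = ‖*‖≤-≥2 k j refl

‖‖≤3+‖/3‖ : ∀ n → 3 ∣ n → ‖ n ‖ ≤ 3 + ‖ n / 3 ‖
‖‖≤3+‖/3‖ _ (divides q refl) = begin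
  ‖ q * 3 ‖         ≡⟨ cong ‖_‖ (*-comm q 3) ⟩
  ‖ 3 * q ‖         ≤⟨ ‖*‖≤ 3 q ⟩
  3 + ‖ q ‖         ≡⟨ cong (λ d → 3 + ‖ d ‖) (m*n/n≡m q 3) ⟨
  3 + ‖ q * 3 / 3 ‖ ∎
  where open ≤-Reasoning

‖3^k*‖≤ : ∀ k x → ‖ 3 ^ k * x ‖ ≤ 3 * k + ‖ x ‖
‖3^k*‖≤ zero    x = ≤-reflexive (cong ‖_‖ (*-identityˡ x))
‖3^k*‖≤ (suc k) x = begin
  ‖ 3 * 3 ^ k * x ‖   ≡⟨ cong ‖_‖ (*-assoc 3 (3 ^ k) x) ⟩
  ‖ 3 * (3 ^ k * x) ‖ ≤⟨ ‖*‖≤ 3 (3 ^ k * x) ⟩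
  3 + ‖ 3 ^ k * x ‖   ≤⟨ +-monoʳ-≤ 3 (‖3^k*‖≤ k x) ⟩
  3 + (3 * k + ‖ x ‖) ≡⟨ +-assoc 3 (3 * k) ‖ x ‖ ⟨
  3 + 3 * k + ‖ x ‖   ≡⟨ cong (_+ ‖ x ‖) (*-suc 3 k) ⟨
  3 * suc k + ‖ x ‖   ∎
  where open ≤-Reasoning

module _ {m m′ c : ℕ}
         (‖*m′‖≤ : ∀ x → ‖ x * m′ ‖ ≤ ‖ x ‖ + c)
         (‖mm′‖≡ : ‖ m * m′ ‖ ≡ ‖ m ‖ + c) where

  leader-of-product : Leader (m * m′) → Leader m
  leader-of-product leader (divides q m≡q3 , ‖m‖≡) = leader (divides (q * m′) n≡ , ‖n‖≡)
    where
    open ≤-Reasoning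
    n≡ : m * m′ ≡ q * m′ * 3
    n≡ = begin-equality
      m * m′       ≡⟨ cong (_* m′) m≡q3 ⟩
      q * 3 * m′   ≡⟨ *-assoc q 3 m′ ⟩
      q * (3 * m′) ≡⟨ cong (q *_) (*-comm 3 m′) ⟩
      q * (m′ * 3) ≡⟨ *-assoc q m′ 3 ⟨
      q * m′ * 3   ∎
    m/3≡q : m / 3 ≡ q
    m/3≡q = trans (cong (_/ 3) m≡q3) (m*n/n≡m q 3)
    n/3≡ : m * m′ / 3 ≡ q * m′
    n/3≡ = trans (cong (_/ 3) n≡) (m*n/n≡m (q * m′) 3)
    ‖n‖≡ : ‖ m * m′ ‖ ≡ 3 + ‖ m * m′ / 3 ‖
    ‖n‖≡ = ≤-antisym (‖‖≤3+‖/3‖ (m * m′) (divides (q * m′) n≡)) (begin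
      3 + ‖ m * m′ / 3 ‖ ≡⟨ cong (λ d → 3 + ‖ d ‖) n/3≡ ⟩
      3 + ‖ q * m′ ‖     ≤⟨ +-monoʳ-≤ 3 (‖*m′‖≤ q) ⟩
      3 + (‖ q ‖ + c)    ≡⟨ +-assoc 3 ‖ q ‖ c ⟨
      3 + ‖ q ‖ + c      ≡⟨ cong (λ d → 3 + ‖ d ‖ + c) m/3≡q ⟨
      3 + ‖ m / 3 ‖ + c  ≡⟨ cong (_+ c) ‖m‖≡ ⟨
      ‖ m ‖ + c          ≡⟨ ‖mm′‖≡ ⟨
      ‖ m * m′ ‖         ∎)

  stable-of-product : Stable (m * m′) → Stable m
  stable-of-product stable k k≥1 = ≤-antisym (‖3^k*‖≤ k m) (+-cancelʳ-≤ c _ _ (begin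
    3 * k + ‖ m ‖ + c     ≡⟨ +-assoc (3 * k) ‖ m ‖ c ⟩
    3 * k + (‖ m ‖ + c)   ≡⟨ cong (3 * k +_) ‖mm′‖≡ ⟨
    3 * k + ‖ m * m′ ‖    ≡⟨ stable k k≥1 ⟨
    ‖ 3 ^ k * (m * m′) ‖  ≡⟨ cong ‖_‖ (*-assoc (3 ^ k) m m′) ⟨
    ‖ 3 ^ k * m * m′ ‖    ≤⟨ ‖*m′‖≤ (3 ^ k * m) ⟩
    ‖ 3 ^ k * m ‖ + c     ∎))
    where open ≤-Reasoning

sumCpxOver : ∀ {r} → (Fin r → ℕ) → Subset r → ℕ
sumCpxOver {zero}  u []            = 0
sumCpxOver {suc r} u (inside  ∷ I) = ‖ u zero ‖ + sumCpxOver (λ i → u (suc i)) I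
sumCpxOver {suc r} u (outside ∷ I) = sumCpxOver (λ i → u (suc i)) I

prodAll-split : ∀ {r} (u : Fin r → ℕ) I → prodAll u ≡ prodOver u I * prodOver u (∁ I)
prodAll-split {zero}  u []            = refl
prodAll-split {suc r} u (inside  ∷ I) =
  trans (cong (u zero *_) (prodAll-split (λ i → u (suc i)) I)) (sym (*-assoc (u zero) _ _))
prodAll-split {suc r} u (outside ∷ I) =
  trans (cong (u zero *_) (prodAll-split u′ I)) (x∙yz≈y∙xz *-commutativeSemigroup (u zero) P P∁)
  where
  u′ = λ i → u (suc i)
  P = prodOver u′ I
  P∁ = prodOver u′ (∁ I)

sumCpx-split : ∀ {r} (u : Fin r → ℕ) I → sumCpx u ≡ sumCpxOver u I + sumCpxOver u (∁ I)
sumCpx-split {zero}  u []            = refl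
sumCpx-split {suc r} u (inside  ∷ I) =
  trans (cong (‖ u zero ‖ +_) (sumCpx-split (λ i → u (suc i)) I)) (sym (+-assoc ‖ u zero ‖ _ _))
sumCpx-split {suc r} u (outside ∷ I) =
  trans (cong (‖ u zero ‖ +_) (sumCpx-split u′ I)) (x∙yz≈y∙xz +-commutativeSemigroup ‖ u zero ‖ S S∁)
  where
  u′ = λ i → u (suc i)
  S = sumCpxOver u′ I
  S∁ = sumCpxOver u′ (∁ I)

‖*prodOver‖≤ : ∀ {r} (u : Fin r → ℕ) I x → ‖ x * prodOver u I ‖ ≤ ‖ x ‖ + sumCpxOver u I
‖*prodOver‖≤ {zero}  u []            x =
  ≤-reflexive (trans (cong ‖_‖ (*-identityʳ x)) (sym (+-identityʳ _)))
‖*prodOver‖≤ {suc r} u (outside ∷ I) x = ‖*prodOver‖≤ (λ i → u (suc i)) I x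
‖*prodOver‖≤ {suc r} u (inside  ∷ I) x = begin
  ‖ x * (u zero * P) ‖     ≡⟨ cong ‖_‖ (*-assoc x (u zero) P) ⟨
  ‖ x * u zero * P ‖       ≤⟨ ‖*prodOver‖≤ (λ i → u (suc i)) I (x * u zero) ⟩
  ‖ x * u zero ‖ + S       ≤⟨ +-monoˡ-≤ S (‖*‖≤ x (u zero)) ⟩
  ‖ x ‖ + ‖ u zero ‖ + S   ≡⟨ +-assoc ‖ x ‖ _ S ⟩
  ‖ x ‖ + (‖ u zero ‖ + S) ∎
  where
  open ≤-Reasoning
  P = prodOver (λ i → u (suc i)) I
  S = sumCpxOver (λ i → u (suc i)) I

‖prodOver‖≤ : ∀ {r} (u : Fin r → ℕ) I → Nonempty I → ‖ prodOver u I ‖ ≤ sumCpxOver u I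
‖prodOver‖≤ {suc r} u (inside  ∷ I) _                 = ‖*prodOver‖≤ (λ i → u (suc i)) I (u zero)
‖prodOver‖≤ {suc r} u (outside ∷ I) (suc i , there i∈) =
  ‖prodOver‖≤ (λ i → u (suc i)) I (i , i∈)

prodOver-good : ∀ {r} (u : Fin r → ℕ) I → Nonempty I → ‖ prodAll u ‖ ≡ sumCpx u →
                ‖ prodOver u I * prodOver u (∁ I) ‖ ≡ ‖ prodOver u I ‖ + sumCpxOver u (∁ I)
prodOver-good u I I≢∅ good = ≤-antisym (‖*prodOver‖≤ u (∁ I) (prodOver u I)) (begin
  ‖ prodOver u I ‖ + sumCpxOver u (∁ I)    ≤⟨ +-monoˡ-≤ _ (‖prodOver‖≤ u I I≢∅) ⟩
  sumCpxOver u I + sumCpxOver u (∁ I)      ≡⟨ sumCpx-split u I ⟨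
  sumCpx u                                 ≡⟨ good ⟨
  ‖ prodAll u ‖                            ≡⟨ cong ‖_‖ (prodAll-split u I) ⟩
  ‖ prodOver u I * prodOver u (∁ I) ‖      ∎)
  where open ≤-Reasoning

proposition3p9 : (n : ℕ) → 0 < n → (r : ℕ) → (u : Fin r → ℕ) →
    GoodFactorization n u → (I : Subset r) → Nonempty I →
    (Leader n → Leader (prodOver u I)) × (Stable n → Stable (prodOver u I))
proposition3p9 _ _ _ u (_ , refl , good) I I≢∅ =
  subst (λ n → (Leader n → Leader m) × (Stable n → Stable m)) (sym (prodAll-split u I))
    (leader-of-product bound good′ , stable-of-product bound good′)
  where
  m = prodOver u I
  bound : ∀ x → ‖ x * prodOver u (∁ I) ‖ ≤ ‖ x ‖ + sumCpxOver u (∁ I)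
  bound = ‖*prodOver‖≤ u (∁ I)
  good′ : ‖ m * prodOver u (∁ I) ‖ ≡ ‖ m ‖ + sumCpxOver u (∁ I)
  good′ = prodOver-good u I I≢∅ good
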